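{- Let $d$ and $n$ be integers with $1\le d\le n$, and let $E$ be a set of hyperedges of size at most $d$ on $[n]$. Let $p$ be an integer with $1\le p\le\min\{|e'\setminus e|: e,e'\in E,\ e\neq e'\}$. Then there exists a non-adaptive group testing algorithm that finds the defective hyperedge in $E$ using at most $t=O\left(\frac{d}{p}\log|E|\right)$ tests.
   Context: Group testing on a hypergraph with vertex set $[n]$ and hyperedge set $E$: exactly one hyperedge $e^*\in E$ is defective. A test on a pool $T\subseteq[n]$ is positive if and only if $T\cap e^*\neq\emptyset$. A non-adaptive algorithm chooses all its pools in advance and determines its output from the vector of responses; finding the defective hyperedge means its output is $e^*$ for every possible choice of $e^*\in E$. -}

module Defs where

open import Data.Nat using (ℕ)
open import Data.Bool using (Bool)
open import Data.Fin using (Fin)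
open import Data.Fin.Subset using (Subset; _∩_; Nonempty)
open import Data.Fin.Subset.Properties using (nonempty?)
open import Data.List using (List)
open import Data.List.Relation.Unary.All using (All)
open import Data.Product using (Σ; _×_)
open import Relation.Nullary using (does)
open import Relation.Binary.PropositionalEquality using (_≡_)

testResult : ∀ {n} → Subset n → Subset n → Bool
testResult T e = does (nonempty? (T ∩ e))

record NonAdaptive (n t : ℕ) : Set where
  field
    pools  : Fin t → Subset n
    decode : (Fin t → Bool) → Subset n

open NonAdaptive public

responses : ∀ {n t} → NonAdaptive n t → Subset n → (Fin t → Bool)
responses A e i = testResult (pools A i) e

Finds : ∀ {n t} → NonAdaptive n t → List (Subset n) → Set
Finds A E = All (λ e → decode A (responses A e) ≡ e) E

module Submission where

open import Algebra.Bundles using (CommutativeMonoid)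
open import Data.Bool using (Bool; true; false; _∧_; _∨_; not; T?)
import Data.Bool as Bool
open import Data.Bool.Properties using (∨-commutativeMonoid; ∧-distribˡ-∨; T-not-≡)
open import Algebra.Properties.CommutativeSemigroup
  (CommutativeMonoid.commutativeSemigroup ∨-commutativeMonoid) using (interchange)
open import Data.Fin using (Fin; zero; suc)
open import Data.Fin.Properties using (any?; all?)
open import Data.Fin.Subset using (Subset; inside; outside; _∩_; _∪_; _─_; ∣_∣; Nonempty)
import Data.Fin.Subset as Subset
open import Data.Fin.Subset.Properties using (_∈?_; nonempty?; drop-there; ∣p─q∣≤∣p∣)
open import Data.List using (List; []; _∷_; _++_; length; map; filter; filterᵇ; cartesianProduct)
open import Data.List.Membership.Propositional using (_∈_)
open import Data.List.Membership.Propositional.Properties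
  using (∈-filter⁺; ∈-filter⁻; ∈-cartesianProduct⁺; ∈-cartesianProduct⁻)
open import Data.List.Properties using (length-++; length-map; length-filter)
open import Data.List.Relation.Unary.All using (All)
import Data.List.Relation.Unary.All as All
open import Data.List.Relation.Unary.All.Properties using (filter⁺)
import Data.List.Relation.Unary.AllPairs as AllPairs
open import Data.List.Relation.Unary.Any using (here; there)
open import Data.List.Relation.Unary.Unique.Propositional using (Unique)
open import Data.Nat
open import Data.Nat.DivMod using (_/_; _%_; m≡m%n+[m/n]*n; m%n<n; m/n*n≤m)
open import Data.Nat.Induction using (<-wellFounded)
open import Data.Nat.ListAction using (sum)
open import Data.Nat.Logarithm using (⌈log₂_⌉)
open import Data.Nat.Logarithm.Core using (⌈log2⌉)
open import Data.Nat.Properties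
open import Data.Nat.Solver using (module +-*-Solver)
open import Data.Product using (∃; _,_; _×_)
open import Data.Vec using (Vec; []; _∷_; lookup)
import Data.Vec as Vec
open import Data.Vec.Properties using (≡-dec)
open import Function using (_∘_)
open import Function.Bundles using (_⇔_; mk⇔; Equivalence)
open import Induction.WellFounded using (Acc; acc)
open import Relation.Binary.PropositionalEquality
open import Relation.Nullary using (Dec; does; yes; no; ¬?; contradiction)
open import Relation.Nullary.Decidable using (does-⇔)

open import Defs

open +-*-Solver

-- A random pool containing each vertex independently with probability 1/(2d) misses a
-- hyperedge e (∣ e ∣ ≤ d) with probability at least 1/2 and, independently, meets e′ ─ e
-- (of size at least p) with probability at least p/(4d); so it separates every ordered pair
-- e ≢ e′ of E with probability at least p/(8d). Derandomising greedily, some pool separates a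
-- p/(8d) fraction of the pairs not yet separated, hence k ≈ 8d/p pools halve their number and
-- k (2 ⌈log₂ ∣ E ∣⌉ + 1) pools separate all of the at most ∣ E ∣ ^ 2 pairs. Decoding to the first
-- hyperedge of E consistent with the responses is then correct.

-- Random pools

-- Σ_{T ⊆ [n]} b ^ (n − ∣ T ∣) · f T, that is (1 + b) ^ n times the expectation of f for a
-- random pool containing each vertex independently with probability 1 / (1 + b).
biasedSum : ℕ → ∀ n → (Subset n → ℕ) → ℕ
biasedSum b zero    f = f []
biasedSum b (suc n) f = biasedSum b n (f ∘ (inside ∷_)) + b * biasedSum b n (f ∘ (outside ∷_))

module _ (b : ℕ) where

  biasedSum-cong : ∀ n {f g : Subset n → ℕ} → (∀ T → f T ≡ g T) → biasedSum b n f ≡ biasedSum b n g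
  biasedSum-cong zero    f≗g = f≗g []
  biasedSum-cong (suc n) f≗g =
    cong₂ (λ x y → x + b * y) (biasedSum-cong n (f≗g ∘ (inside ∷_))) (biasedSum-cong n (f≗g ∘ (outside ∷_)))

  biasedSum-+ : ∀ n (f g : Subset n → ℕ) →
    biasedSum b n (λ T → f T + g T) ≡ biasedSum b n f + biasedSum b n g
  biasedSum-+ zero    f g = refl
  biasedSum-+ (suc n) f g = begin
      biasedSum b (suc n) (λ T → f T + g T)
    ≡⟨ cong₂ (λ x y → x + b * y) (biasedSum-+ n _ _) (biasedSum-+ n _ _) ⟩
      (xᵢ + yᵢ) + b * (xₒ + yₒ)
    ≡⟨ solve 5 (λ b xᵢ yᵢ xₒ yₒ → (xᵢ :+ yᵢ) :+ b :* (xₒ :+ yₒ) := (xᵢ :+ b :* xₒ) :+ (yᵢ :+ b :* yₒ))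
         refl b xᵢ yᵢ xₒ yₒ ⟩
      (xᵢ + b * xₒ) + (yᵢ + b * yₒ)
    ∎
    where
    open ≡-Reasoning
    xᵢ yᵢ xₒ yₒ : ℕ
    xᵢ = biasedSum b n (f ∘ (inside ∷_))
    yᵢ = biasedSum b n (g ∘ (inside ∷_))
    xₒ = biasedSum b n (f ∘ (outside ∷_))
    yₒ = biasedSum b n (g ∘ (outside ∷_))

  biasedSum-*ˡ : ∀ n k (f : Subset n → ℕ) → biasedSum b n (λ T → k * f T) ≡ k * biasedSum b n f
  biasedSum-*ˡ zero    k f = refl
  biasedSum-*ˡ (suc n) k f =
    trans (cong₂ (λ x y → x + b * y) (biasedSum-*ˡ n k _) (biasedSum-*ˡ n k _))
          (solve 4 (λ b k x y → k :* x :+ b :* (k :* y) := k :* (x :+ b :* y)) refl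
             b k (biasedSum b n (f ∘ (inside ∷_))) (biasedSum b n (f ∘ (outside ∷_))))

  biasedSum-zero : ∀ n → biasedSum b n (λ _ → 0) ≡ 0
  biasedSum-zero n = biasedSum-*ˡ n 0 (λ _ → 0)

  biasedSum-averaging : ∀ n (f : Subset n → ℕ) c →
    c * suc b ^ n ≤ biasedSum b n f → ∃ λ T → c ≤ f T
  biasedSum-averaging zero    f c h = [] , subst (_≤ f []) (*-identityʳ c) h
  biasedSum-averaging (suc n) f c h
    with c * suc b ^ n ≤? biasedSum b n (f ∘ (inside ∷_))
       | c * suc b ^ n ≤? biasedSum b n (f ∘ (outside ∷_))
  ... | yes hᵢ | _ = let T , q = biasedSum-averaging n _ c hᵢ in inside ∷ T , q
  ... | no _ | yes hₒ = let T , q = biasedSum-averaging n _ c hₒ in outside ∷ T , q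
  ... | no hᵢ | no hₒ = contradiction h (<⇒≱ (begin-strict
        biasedSum b (suc n) f
      ≡⟨⟩
        X + b * Y
      <⟨ +-mono-<-≤ (≰⇒> hᵢ) (*-monoʳ-≤ b (<⇒≤ (≰⇒> hₒ))) ⟩
        c * suc b ^ n + b * (c * suc b ^ n)
      ≡⟨ solve 3 (λ c b x → c :* x :+ b :* (c :* x) := c :* ((con 1 :+ b) :* x)) refl c b (suc b ^ n) ⟩
        c * suc b ^ suc n
      ∎))
    where
    open ≤-Reasoning
    X Y : ℕ
    X = biasedSum b n (f ∘ (inside ∷_))
    Y = biasedSum b n (f ∘ (outside ∷_))

testResult-∷ : ∀ {n} t x (T e : Subset n) → testResult (t ∷ T) (x ∷ e) ≡ (t ∧ x) ∨ testResult T e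
testResult-∷ t x T e =
  cong₂ _∨_ (does-zero∈? (t ∧ x)) (does-⇔ dropHead (any? (λ i → suc i ∈? (t ∧ x) ∷ T ∩ e)) (nonempty? (T ∩ e)))
  where
  does-zero∈? : ∀ s → does (zero ∈? (s ∷ T ∩ e)) ≡ s
  does-zero∈? inside  = refl
  does-zero∈? outside = refl
  dropHead : (∃ λ i → suc i Subset.∈ (t ∧ x) ∷ T ∩ e) ⇔ Nonempty (T ∩ e)
  dropHead = mk⇔ (λ (i , i∈) → i , drop-there i∈) (λ (i , i∈) → i , Vec.there i∈)

testResult-∪ : ∀ {n} (T e e′ : Subset n) → testResult T (e ∪ e′) ≡ testResult T e ∨ testResult T e′
testResult-∪ []      []      []        = refl
testResult-∪ (t ∷ T) (x ∷ e) (y ∷ e′) = begin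
    testResult (t ∷ T) ((x ∨ y) ∷ e ∪ e′)
  ≡⟨ testResult-∷ t (x ∨ y) T (e ∪ e′) ⟩
    t ∧ (x ∨ y) ∨ testResult T (e ∪ e′)
  ≡⟨ cong₂ _∨_ (∧-distribˡ-∨ t x y) (testResult-∪ T e e′) ⟩
    (t ∧ x ∨ t ∧ y) ∨ (testResult T e ∨ testResult T e′)
  ≡⟨ interchange (t ∧ x) (t ∧ y) (testResult T e) (testResult T e′) ⟩
    (t ∧ x ∨ testResult T e) ∨ (t ∧ y ∨ testResult T e′)
  ≡⟨ sym (cong₂ _∨_ (testResult-∷ t x T e) (testResult-∷ t y T e′)) ⟩
    testResult (t ∷ T) (x ∷ e) ∨ testResult (t ∷ T) (y ∷ e′)
  ∎
  where open ≡-Reasoning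

∣p∪q∣≡∣p∣+∣q─p∣ : ∀ {n} (p q : Subset n) → ∣ p ∪ q ∣ ≡ ∣ p ∣ + ∣ q ─ p ∣
∣p∪q∣≡∣p∣+∣q─p∣ []            []            = refl
∣p∪q∣≡∣p∣+∣q─p∣ (inside  ∷ p) (_       ∷ q) = cong suc (∣p∪q∣≡∣p∣+∣q─p∣ p q)
∣p∪q∣≡∣p∣+∣q─p∣ (outside ∷ p) (inside  ∷ q) =
  trans (cong suc (∣p∪q∣≡∣p∣+∣q─p∣ p q)) (sym (+-suc ∣ p ∣ ∣ q ─ p ∣))
∣p∪q∣≡∣p∣+∣q─p∣ (outside ∷ p) (outside ∷ q) = ∣p∪q∣≡∣p∣+∣q─p∣ p q

-- Separation probability

indicator : Bool → ℕ
indicator true  = 1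
indicator false = 0

missed : ∀ {n} → Subset n → Subset n → ℕ
missed e T = indicator (not (testResult T e))

missed-∷ : ∀ {n} t x (T e : Subset n) → missed (x ∷ e) (t ∷ T) ≡ indicator (not (t ∧ x ∨ testResult T e))
missed-∷ t x T e = cong (indicator ∘ not) (testResult-∷ t x T e)

module _ (b : ℕ) where

  private
    N : ℕ
    N = suc b

  biasedSum-missed : ∀ {n} (e : Subset n) → biasedSum b n (missed e) * N ^ ∣ e ∣ ≡ N ^ n * b ^ ∣ e ∣
  biasedSum-missed [] = refl
  biasedSum-missed {suc n} (inside ∷ e) = begin
      biasedSum b (suc n) (missed (inside ∷ e)) * N ^ suc ∣ e ∣
    ≡⟨ cong (λ s → s * N ^ suc ∣ e ∣) (cong₂ (λ x y → x + b * y)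
         (trans (biasedSum-cong b n (λ T → missed-∷ inside inside T e)) (biasedSum-zero b n))
         (biasedSum-cong b n (λ T → missed-∷ outside inside T e))) ⟩
      b * S * N ^ suc ∣ e ∣
    ≡⟨ solve 4 (λ b S x N → b :* S :* (N :* x) := b :* N :* (S :* x)) refl b S (N ^ ∣ e ∣) N ⟩
      b * N * (S * N ^ ∣ e ∣)
    ≡⟨ cong (b * N *_) (biasedSum-missed e) ⟩
      b * N * (N ^ n * b ^ ∣ e ∣)
    ≡⟨ solve 4 (λ b N x y → b :* N :* (x :* y) := N :* x :* (b :* y)) refl b N (N ^ n) (b ^ ∣ e ∣) ⟩
      N ^ suc n * b ^ suc ∣ e ∣
    ∎
    where
    open ≡-Reasoning
    S : ℕ
    S = biasedSum b n (missed e)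
  biasedSum-missed {suc n} (outside ∷ e) = begin
      biasedSum b (suc n) (missed (outside ∷ e)) * N ^ ∣ e ∣
    ≡⟨ cong (λ s → s * N ^ ∣ e ∣) (cong₂ (λ x y → x + b * y)
         (biasedSum-cong b n (λ T → missed-∷ inside outside T e))
         (biasedSum-cong b n (λ T → missed-∷ outside outside T e))) ⟩
      N * S * N ^ ∣ e ∣
    ≡⟨ *-assoc N S (N ^ ∣ e ∣) ⟩
      N * (S * N ^ ∣ e ∣)
    ≡⟨ cong (N *_) (biasedSum-missed e) ⟩
      N * (N ^ n * b ^ ∣ e ∣)
    ≡⟨ *-assoc N (N ^ n) (b ^ ∣ e ∣) ⟨
      N ^ suc n * b ^ ∣ e ∣
    ∎
    where
    open ≡-Reasoning
    S : ℕ
    S = biasedSum b n (missed e)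

separates : ∀ {n} → Subset n → Subset n × Subset n → Bool
separates T (e , e′) = not (testResult T e) ∧ testResult T e′

missed≡separated+missed∪ : ∀ {n} (e e′ T : Subset n) →
  missed e T ≡ indicator (separates T (e , e′)) + missed (e ∪ e′) T
missed≡separated+missed∪ e e′ T rewrite testResult-∪ T e e′ with testResult T e | testResult T e′
... | true  | _     = refl
... | false | true  = refl
... | false | false = refl

-- (1 + p/c) ^ (k + 1) ≥ 1 + (k + 1) p/c, cleared of denominators.
bernoulli : ∀ c p k → c ^ k * (c + p + k * p) ≤ (c + p) ^ suc k
bernoulli c p zero = ≤-reflexive (solve 2 (λ c p → con 1 :* (c :+ p :+ con 0) := (c :+ p) :* con 1) refl c p)
bernoulli c p (suc k) = begin
    c ^ suc k * (c + p + suc k * p)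
  ≡⟨ solve 4 (λ c p k u → (c :* u) :* (c :+ p :+ (p :+ k :* p)) := c :* u :* (c :+ p :+ p :+ k :* p))
       refl c p k u ⟩
    c * u * (c + p + p + k * p)
  ≤⟨ m≤m+n _ (u * p * (p + k * p)) ⟩
    c * u * (c + p + p + k * p) + u * p * (p + k * p)
  ≡⟨ solve 4 (λ c p k u → c :* u :* (c :+ p :+ p :+ k :* p) :+ u :* p :* (p :+ k :* p)
                       := (c :+ p) :* (u :* (c :+ p :+ k :* p))) refl c p k u ⟩
    (c + p) * (u * (c + p + k * p))
  ≤⟨ *-monoʳ-≤ (c + p) (bernoulli c p k) ⟩
    (c + p) * (c + p) ^ suc k
  ∎
  where
  open ≤-Reasoning
  u : ℕ
  u = c ^ k

-- (1 − 1/N) ^ α ≥ 1 − α/N for N = 1 + b, cleared of denominators.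
bernoulli⁻ : ∀ b α → suc b ^ suc α ≤ b ^ α * suc b + α * suc b ^ α
bernoulli⁻ b zero = ≤-reflexive (solve 1 (λ b → (con 1 :+ b) :* con 1 := con 1 :* (con 1 :+ b) :+ con 0) refl b)
bernoulli⁻ b (suc α) = begin
    N * (N * v)
  ≡⟨ solve 2 (λ b v → (con 1 :+ b) :* ((con 1 :+ b) :* v) := b :* ((con 1 :+ b) :* v) :+ (con 1 :+ b) :* v)
       refl b v ⟩
    b * (N * v) + N * v
  ≤⟨ +-monoˡ-≤ (N * v) (*-monoʳ-≤ b (bernoulli⁻ b α)) ⟩
    b * (u * N + α * v) + N * v
  ≤⟨ m≤m+n _ (α * v) ⟩
    b * (u * N + α * v) + N * v + α * v
  ≡⟨ solve 4 (λ b α u v → b :* (u :* (con 1 :+ b) :+ α :* v) :+ (con 1 :+ b) :* v :+ α :* v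
                       := (b :* u) :* (con 1 :+ b) :+ (con 1 :+ α) :* ((con 1 :+ b) :* v)) refl b α u v ⟩
    b * u * N + suc α * (N * v)
  ∎
  where
  open ≤-Reasoning
  N v u : ℕ
  N = suc b
  v = suc b ^ α
  u = b ^ α

-- A random pool misses a fixed set of size α ≤ N/2 with probability (1 − 1/N) ^ α ≥ 1/2.
missProbability≥½ : ∀ b α → 2 * α ≤ suc b → suc b ^ α ≤ 2 * b ^ α
missProbability≥½ b α 2α≤N = *-cancelʳ-≤ (N ^ α) (2 * b ^ α) N (+-cancelʳ-≤ (N * N ^ α) _ _ (begin
    N ^ α * N + N * N ^ α
  ≡⟨ solve 2 (λ N v → v :* N :+ N :* v := con 2 :* (N :* v)) refl N (N ^ α) ⟩
    2 * N ^ suc α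
  ≤⟨ *-monoʳ-≤ 2 (bernoulli⁻ b α) ⟩
    2 * (b ^ α * N + α * N ^ α)
  ≡⟨ solve 4 (λ N u α v → con 2 :* (u :* N :+ α :* v) := con 2 :* u :* N :+ (con 2 :* α) :* v)
       refl N (b ^ α) α (N ^ α) ⟩
    2 * b ^ α * N + 2 * α * N ^ α
  ≤⟨ +-monoʳ-≤ (2 * b ^ α * N) (*-monoˡ-≤ (N ^ α) 2α≤N) ⟩
    2 * b ^ α * N + N * N ^ α
  ∎))
  where
  open ≤-Reasoning
  N : ℕ
  N = suc b

-- A random pool meets a fixed set of size β ≥ p with probability 1 − (1 − 1/N) ^ β ≥ p/(2N).
hitProbability≥p/2N : ∀ b p β → p ≤ β → p ≤ suc b →
  2 * suc b * b ^ β + p * suc b ^ β ≤ 2 * suc b * suc b ^ β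
hitProbability≥p/2N b p β p≤β p≤N = *-cancelʳ-≤ _ _ (N + p) (begin
    (2 * N * w + p * v) * (N + p)
  ≡⟨ solve 5 (λ N w p v x → (con 2 :* N :* w :+ p :* v) :* x := con 2 :* N :* (w :* x) :+ p :* v :* x)
       refl N w p v (N + p) ⟩
    2 * N * (w * (N + p)) + p * v * (N + p)
  ≤⟨ +-monoˡ-≤ (p * v * (N + p)) (*-monoʳ-≤ (2 * N) missAll) ⟩
    2 * N * (N * v) + p * v * (N + p)
  ≤⟨ +-monoʳ-≤ (2 * N * (N * v)) (*-monoʳ-≤ (p * v) (+-monoʳ-≤ N p≤N)) ⟩
    2 * N * (N * v) + p * v * (N + N)
  ≡⟨ solve 3 (λ N p v → con 2 :* N :* (N :* v) :+ p :* v :* (N :+ N) := con 2 :* N :* v :* (N :+ p))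
       refl N p v ⟩
    2 * N * v * (N + p)
  ∎)
  where
  open ≤-Reasoning
  N w v : ℕ
  N = suc b
  w = b ^ β
  v = suc b ^ β
  missAll : w * (N + p) ≤ N * v
  missAll = begin
    w * (N + p)              ≤⟨ *-monoʳ-≤ w (+-monoʳ-≤ N p≤β) ⟩
    w * (N + β)              ≡⟨ cong (w *_) (solve 2 (λ b β → (con 1 :+ b) :+ β := b :+ con 1 :+ β :* con 1) refl b β) ⟩
    w * (b + 1 + β * 1)      ≤⟨ bernoulli b 1 β ⟩
    (b + 1) ^ suc β          ≡⟨ cong (_^ suc β) (+-comm b 1) ⟩
    N * v                    ∎

separationWeight : ∀ b {n} (e e′ : Subset n) p → 2 * ∣ e ∣ ≤ suc b → p ≤ ∣ e′ ─ e ∣ → p ≤ suc b →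
  p * suc b ^ n ≤ 4 * suc b * biasedSum b n (λ T → indicator (separates T (e , e′)))
separationWeight b {n} e e′ p 2α≤N p≤β p≤N =
  *-cancelʳ-≤ _ _ K {{m*n≢0 (N ^ α) v {{m^n≢0 N α}} {{m^n≢0 N β}}}} (+-cancelʳ-≤ (a * Y * K) _ _ (begin
    p * M * K + a * Y * K
  ≡⟨ cong (p * M * K +_) Y-scaled ⟩
    p * M * K + M * (a * u * w)
  ≡⟨ solve 7 (λ p M x v a u w → p :* M :* (x :* v) :+ M :* (a :* u :* w) := M :* (p :* x :* v :+ a :* u :* w))
       refl p M (N ^ α) v a u w ⟩
    M * (p * N ^ α * v + a * u * w)
  ≤⟨ *-monoʳ-≤ M probabilities ⟩
    M * (a * u * v)
  ≡⟨ X-scaled ⟨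
    a * X * K
  ≡⟨ cong (λ z → a * z * K) X≡G+Y ⟩
    a * (G + Y) * K
  ≡⟨ solve 4 (λ a G Y K → a :* (G :+ Y) :* K := a :* G :* K :+ a :* Y :* K) refl a G Y K ⟩
    a * G * K + a * Y * K
  ∎))
  where
  open ≤-Reasoning
  N a M α β u w v K G X Y : ℕ
  N = suc b
  a = 4 * N
  M = N ^ n
  α = ∣ e ∣
  β = ∣ e′ ─ e ∣
  u = b ^ α
  w = b ^ β
  v = N ^ β
  K = N ^ α * v
  G = biasedSum b n (λ T → indicator (separates T (e , e′)))
  X = biasedSum b n (missed e)
  Y = biasedSum b n (missed (e ∪ e′))
  X≡G+Y : X ≡ G + Y
  X≡G+Y = trans (biasedSum-cong b n (missed≡separated+missed∪ e e′)) (biasedSum-+ b n _ _)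
  X-scaled : a * X * K ≡ M * (a * u * v)
  X-scaled = begin-equality
    a * X * (N ^ α * v)   ≡⟨ solve 4 (λ a X x v → a :* X :* (x :* v) := a :* (X :* x) :* v)
                                refl a X (N ^ α) v ⟩
    a * (X * N ^ α) * v   ≡⟨ cong (λ z → a * z * v) (biasedSum-missed b e) ⟩
    a * (M * u) * v       ≡⟨ solve 4 (λ a M u v → a :* (M :* u) :* v := M :* (a :* u :* v)) refl a M u v ⟩
    M * (a * u * v)       ∎
  Y-scaled : a * Y * K ≡ M * (a * u * w)
  Y-scaled = begin-equality
    a * Y * (N ^ α * v)   ≡⟨ cong (λ z → a * Y * z) (^-distribˡ-+-* N α β) ⟨
    a * Y * N ^ (α + β)   ≡⟨ cong (λ z → a * Y * N ^ z) (∣p∪q∣≡∣p∣+∣q─p∣ e e′) ⟨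
    a * Y * N ^ ∣ e ∪ e′ ∣ ≡⟨ *-assoc a Y _ ⟩
    a * (Y * N ^ ∣ e ∪ e′ ∣) ≡⟨ cong (a *_) (biasedSum-missed b (e ∪ e′)) ⟩
    a * (M * b ^ ∣ e ∪ e′ ∣) ≡⟨ cong (λ z → a * (M * b ^ z)) (∣p∪q∣≡∣p∣+∣q─p∣ e e′) ⟩
    a * (M * b ^ (α + β))  ≡⟨ cong (λ z → a * (M * z)) (^-distribˡ-+-* b α β) ⟩
    a * (M * (u * w))      ≡⟨ solve 4 (λ a M u w → a :* (M :* (u :* w)) := M :* (a :* u :* w)) refl a M u w ⟩
    M * (a * u * w)        ∎
  probabilities : p * N ^ α * v + a * u * w ≤ a * u * v
  probabilities = begin
      p * N ^ α * v + a * u * w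
    ≤⟨ +-monoˡ-≤ (a * u * w) (*-monoˡ-≤ v (*-monoʳ-≤ p (missProbability≥½ b α 2α≤N))) ⟩
      p * (2 * u) * v + a * u * w
    ≡⟨ solve 5 (λ N p u v w → p :* (con 2 :* u) :* v :+ con 4 :* N :* u :* w
                           := con 2 :* u :* (con 2 :* N :* w :+ p :* v)) refl N p u v w ⟩
      2 * u * (2 * N * w + p * v)
    ≤⟨ *-monoʳ-≤ (2 * u) (hitProbability≥p/2N b p β p≤β p≤N) ⟩
      2 * u * (2 * N * v)
    ≡⟨ solve 3 (λ N u v → con 2 :* u :* (con 2 :* N :* v) := con 4 :* N :* u :* v) refl N u v ⟩
      a * u * v
    ∎

-- Greedy derandomisation

module Greedy {X R : Set} (covers : X → R → Bool) where

  uncovered : X → List R → List R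
  uncovered x = filterᵇ (not ∘ covers x)

  coverCount : X → List R → ℕ
  coverCount x S = sum (map (indicator ∘ covers x) S)

  length-uncovered : ∀ x S → length (uncovered x S) + coverCount x S ≡ length S
  length-uncovered x []      = refl
  length-uncovered x (s ∷ S) with covers x s
  ... | true  = trans (+-suc _ _) (cong suc (length-uncovered x S))
  ... | false = cong suc (length-uncovered x S)

  uncoveredAfter : ∀ {k} → Vec X k → List R → List R
  uncoveredAfter []       S = S
  uncoveredAfter (x ∷ xs) S = uncoveredAfter xs (uncovered x S)

  greedy : (P : R → Set) (a c : ℕ) →
    (∀ S → All P S → ∃ λ x → a * length (uncovered x S) ≤ c * length S) →
    ∀ k S → All P S → ∃ λ (xs : Vec X k) → a ^ k * length (uncoveredAfter xs S) ≤ c ^ k * length S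
  greedy P a c step zero    S PS = [] , ≤-reflexive (trans (*-identityˡ _) (sym (*-identityˡ _)))
  greedy P a c step (suc k) S PS =
    let x , shrinks = step S PS
        xs , rest   = greedy P a c step k (uncovered x S) (filter⁺ _ PS)
        S′          = uncovered x S
    in x ∷ xs , (begin
      a * a ^ k * length (uncoveredAfter xs S′) ≡⟨ solve 3 (λ a x y → a :* x :* y := x :* y :* a) refl a (a ^ k) _ ⟩
      a ^ k * length (uncoveredAfter xs S′) * a ≤⟨ *-monoˡ-≤ a rest ⟩
      c ^ k * length S′ * a                     ≡⟨ solve 3 (λ a x y → x :* y :* a := x :* (a :* y)) refl a (c ^ k) _ ⟩
      c ^ k * (a * length S′)                   ≤⟨ *-monoʳ-≤ (c ^ k) shrinks ⟩
      c ^ k * (c * length S)                    ≡⟨ solve 3 (λ c x y → x :* (c :* y) := c :* x :* y) refl c (c ^ k) _ ⟩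
      c * c ^ k * length S                      ∎)
    where open ≤-Reasoning

  allCovered : ∀ {k} (xs : Vec X k) {S s} → s ∈ S → length (uncoveredAfter xs S) ≡ 0 →
    ∃ λ i → covers (lookup xs i) s ≡ true
  allCovered [] (here _)  ()
  allCovered [] (there _) ()
  allCovered (x ∷ xs) {s = s} s∈S done with covers x s in eq
  ... | true  = zero , eq
  ... | false =
    let s∈S′ = ∈-filter⁺ (T? ∘ (not ∘ covers x)) s∈S (Equivalence.from T-not-≡ eq)
        i , covered = allCovered xs s∈S′ done
    in suc i , covered

open Greedy using (uncovered; coverCount; length-uncovered; uncoveredAfter; greedy; allCovered)

Admissible : ℕ → ℕ → ∀ {n} → Subset n × Subset n → Set
Admissible b p (e , e′) = 2 * ∣ e ∣ ≤ suc b × p ≤ ∣ e′ ─ e ∣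

module _ (b p : ℕ) (p≤N : p ≤ suc b) where

  private
    N a : ℕ
    N = suc b
    a = 4 * N

  biasedSum-coverCount : ∀ {n} (S : List (Subset n × Subset n)) → All (Admissible b p) S →
    length S * p * N ^ n ≤ a * biasedSum b n (λ T → coverCount separates T S)
  biasedSum-coverCount     []              All.[]                        = z≤n
  biasedSum-coverCount {n} ((e , e′) ∷ S) ((2α≤N , p≤β) All.∷ admS) = begin
      suc (length S) * p * N ^ n
    ≡⟨ solve 3 (λ l p x → (con 1 :+ l) :* p :* x := p :* x :+ l :* p :* x) refl (length S) p (N ^ n) ⟩
      p * N ^ n + length S * p * N ^ n
    ≤⟨ +-mono-≤ (separationWeight b e e′ p 2α≤N p≤β p≤N) (biasedSum-coverCount S admS) ⟩
      a * G + a * biasedSum b n (λ T → coverCount separates T S)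
    ≡⟨ *-distribˡ-+ a G _ ⟨
      a * (G + biasedSum b n (λ T → coverCount separates T S))
    ≡⟨ cong (a *_) (biasedSum-+ b n _ _) ⟨
      a * biasedSum b n (λ T → coverCount separates T ((e , e′) ∷ S))
    ∎
    where
    open ≤-Reasoning
    G : ℕ
    G = biasedSum b n (λ T → indicator (separates T (e , e′)))

  goodPool : ∀ {n} c → c + p ≡ a → (S : List (Subset n × Subset n)) → All (Admissible b p) S →
    ∃ λ T → a * length (uncovered separates T S) ≤ c * length S
  goodPool {n} c c+p≡a S admS with biasedSum-averaging b n (λ T → a * coverCount separates T S) (length S * p)
           (subst (length S * p * N ^ n ≤_) (sym (biasedSum-*ˡ b n a _)) (biasedSum-coverCount S admS))
  ... | T , pS≤aCount = T , +-cancelʳ-≤ (p * length S) _ _ (begin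
      a * U + p * length S
    ≤⟨ +-monoʳ-≤ (a * U) (subst (_≤ a * Count) (*-comm (length S) p) pS≤aCount) ⟩
      a * U + a * Count
    ≡⟨ *-distribˡ-+ a U Count ⟨
      a * (U + Count)
    ≡⟨ cong (a *_) (length-uncovered separates T S) ⟩
      a * length S
    ≡⟨ cong (_* length S) c+p≡a ⟨
      (c + p) * length S
    ≡⟨ *-distribʳ-+ (length S) c p ⟩
      c * length S + p * length S
    ∎)
    where
    open ≤-Reasoning
    U Count : ℕ
    U = length (uncovered separates T S)
    Count = coverCount separates T S

-- Decoding

_≟ₛ_ : ∀ {n} → (e e′ : Subset n) → Dec (e ≡ e′)
_≟ₛ_ = ≡-dec Bool._≟_

separates⇒≢ : ∀ {n} (T e e′ : Subset n) → separates T (e , e′) ≡ true → testResult T e ≢ testResult T e′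
separates⇒≢ T e e′ sep same with testResult T e | testResult T e′
separates⇒≢ T e e′ ()  _  | true  | _
separates⇒≢ T e e′ _   () | false | true
separates⇒≢ T e e′ ()  _  | false | false

Separating : ∀ {n t} → (Fin t → Subset n) → List (Subset n) → Set
Separating pools E =
  ∀ {e e′} → e ∈ E → e′ ∈ E → e ≢ e′ → ∃ λ i → testResult (pools i) e ≢ testResult (pools i) e′

-- Subset.⊥ is a junk value, returned only when no candidate is consistent with the responses.
firstConsistent : ∀ {n t} → (Fin t → Subset n) → List (Subset n) → (Fin t → Bool) → Subset n
firstConsistent pools []       r = Subset.⊥
firstConsistent pools (x ∷ xs) r with all? (λ i → testResult (pools i) x Bool.≟ r i)
... | yes _ = x
... | no  _ = firstConsistent pools xs r

firstConsistent-correct : ∀ {n t} (pools : Fin t → Subset n) E → Separating pools E →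
  ∀ {e} → e ∈ E → firstConsistent pools E (λ i → testResult (pools i) e) ≡ e
firstConsistent-correct pools (x ∷ xs) sep {e} e∈E with all? (λ i → testResult (pools i) x Bool.≟ testResult (pools i) e)
... | yes agree with x ≟ₛ e
...   | yes x≡e = x≡e
...   | no  x≢e = let i , differ = sep (here refl) e∈E x≢e in contradiction (agree i) differ
firstConsistent-correct pools (x ∷ xs) sep (here refl)  | no disagree = contradiction (λ _ → refl) disagree
firstConsistent-correct pools (x ∷ xs) sep (there e∈xs) | no _        =
  firstConsistent-correct pools xs (λ e∈ e′∈ → sep (there e∈) (there e′∈)) e∈xs

separating⇒finds : ∀ {n t} (pools : Fin t → Subset n) E → Separating pools E → ∃ λ (A : NonAdaptive n t) → Finds A E
separating⇒finds pools E sep =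
  record { pools = pools ; decode = firstConsistent pools E } , All.tabulate (firstConsistent-correct pools E sep)

-- Counting the pools

distinctPairs : ∀ {n} → List (Subset n) → List (Subset n × Subset n)
distinctPairs E = filter (λ (e , e′) → ¬? (e ≟ₛ e′)) (cartesianProduct E E)

∈-distinctPairs⁺ : ∀ {n} {E : List (Subset n)} {e e′} → e ∈ E → e′ ∈ E → e ≢ e′ → (e , e′) ∈ distinctPairs E
∈-distinctPairs⁺ e∈E e′∈E e≢e′ = ∈-filter⁺ _ (∈-cartesianProduct⁺ e∈E e′∈E) e≢e′

∈-distinctPairs⁻ : ∀ {n} (E : List (Subset n)) {e e′} → (e , e′) ∈ distinctPairs E → e ∈ E × e′ ∈ E × e ≢ e′
∈-distinctPairs⁻ E e,e′∈ =
  let e,e′∈E×E , e≢e′ = ∈-filter⁻ _ e,e′∈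
      e∈E , e′∈E = ∈-cartesianProduct⁻ E E e,e′∈E×E
  in e∈E , e′∈E , e≢e′

length-cartesianProduct : ∀ {A B : Set} (xs : List A) (ys : List B) →
  length (cartesianProduct xs ys) ≡ length xs * length ys
length-cartesianProduct []       ys = refl
length-cartesianProduct (x ∷ xs) ys = begin
  length (map (x ,_) ys ++ cartesianProduct xs ys)     ≡⟨ length-++ (map (x ,_) ys) ⟩
  length (map (x ,_) ys) + length (cartesianProduct xs ys) ≡⟨ cong₂ _+_ (length-map (x ,_) ys) (length-cartesianProduct xs ys) ⟩
  length ys + length xs * length ys                    ∎
  where open ≡-Reasoning

length-distinctPairs : ∀ {n} (E : List (Subset n)) → length (distinctPairs E) ≤ length E * length E
length-distinctPairs E = ≤-trans (length-filter _ (cartesianProduct E E)) (≤-reflexive (length-cartesianProduct E E))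

n≤2^⌈log₂n⌉ : ∀ n → n ≤ 2 ^ ⌈log₂ n ⌉
n≤2^⌈log₂n⌉ n = go n (<-wellFounded n)
  where
  go : ∀ m (rec : Acc _<_ m) → m ≤ 2 ^ ⌈log2⌉ m rec
  go zero          _        = z≤n
  go (suc zero)    _        = s≤s z≤n
  go (suc (suc m)) (acc _)  = begin
      2 + m                 ≡⟨ cong (2 +_) (⌊n/2⌋+⌈n/2⌉≡n m) ⟨
      2 + (⌊ m /2⌋ + h)     ≤⟨ +-monoʳ-≤ 2 (+-monoˡ-≤ h (⌊n/2⌋≤⌈n/2⌉ m)) ⟩
      2 + (h + h)           ≡⟨ cong suc (+-suc h h) ⟨
      suc h + suc h         ≤⟨ +-mono-≤ ih ih ⟩
      P + P                 ≡⟨ cong (P +_) (+-identityʳ P) ⟨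
      2 * P                 ∎
    where
    open ≤-Reasoning
    h P : ℕ
    h = ⌈ m /2⌉
    P = 2 ^ ⌈log2⌉ (suc h) _
    ih : suc h ≤ P
    ih = go (suc h) _

*-^-distribʳ : ∀ m n o → (m * n) ^ o ≡ m ^ o * n ^ o
*-^-distribʳ m n zero    = refl
*-^-distribʳ m n (suc o) rewrite *-^-distribʳ m n o =
  solve 4 (λ m n x y → m :* n :* (x :* y) := m :* x :* (n :* y)) refl m n (m ^ o) (n ^ o)

-- (1 − p/a) ^ k ≤ 1/2 once k ≥ a/p.
bernoulli-halving : ∀ a c p k .{{_ : NonZero a}} → c + p ≡ a → a ≤ k * p → c ^ k * 2 ≤ a ^ k
bernoulli-halving .(c + p) c p k refl a≤kp = *-cancelʳ-≤ _ _ (c + p) (begin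
  c ^ k * 2 * (c + p)            ≡⟨ solve 2 (λ x a → x :* con 2 :* a := x :* (a :+ a)) refl (c ^ k) (c + p) ⟩
  c ^ k * ((c + p) + (c + p))    ≤⟨ *-monoʳ-≤ (c ^ k) (+-monoʳ-≤ (c + p) a≤kp) ⟩
  c ^ k * (c + p + k * p)        ≤⟨ bernoulli c p k ⟩
  (c + p) ^ suc k                ≡⟨ *-comm (c + p) ((c + p) ^ k) ⟩
  (c + p) ^ k * (c + p)          ∎)
  where open ≤-Reasoning

x*2≤y∧y*r≤x⇒r≡0 : ∀ {x y} r .{{_ : NonZero y}} → x * 2 ≤ y → y * r ≤ x → r ≡ 0
x*2≤y∧y*r≤x⇒r≡0 zero    _      _      = refl
x*2≤y∧y*r≤x⇒r≡0 {x} {y} (suc r) x*2≤y y*r≤x = contradiction (begin-strict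
  y          <⟨ m<m+n y (>-nonZero⁻¹ y) ⟩
  y + y      ≤⟨ +-mono-≤ y≤x y≤x ⟩
  x + x      ≡⟨ cong (x +_) (+-identityʳ x) ⟨
  2 * x      ≡⟨ *-comm 2 x ⟩
  x * 2      ≤⟨ x*2≤y ⟩
  y          ∎) (<-irrefl refl)
  where
  open ≤-Reasoning
  y≤x : y ≤ x
  y≤x = ≤-trans (m≤m*n y (suc r)) y*r≤x

separatingPools : ∀ b p k → p ≤ suc b → 4 * suc b ≤ k * p → ∀ {n} (E : List (Subset n)) →
  All (λ e → 2 * ∣ e ∣ ≤ suc b) E → (∀ {e e′} → e ∈ E → e′ ∈ E → e ≢ e′ → p ≤ ∣ e′ ─ e ∣) →
  ∃ λ (pools : Vec (Subset n) (k * suc (2 * ⌈log₂ length E ⌉))) → Separating (lookup pools) E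
separatingPools b p k p≤N a≤kp {n} E small far =
  let chosen , shrunk = greedy separates (Admissible b p) a c (goodPool b p p≤N c c+p≡a) (k * H) S admissible
  in chosen , separating chosen shrunk
  where
  a c L H : ℕ
  a = 4 * suc b
  c = a ∸ p
  L = ⌈log₂ length E ⌉
  H = suc (2 * L)
  c+p≡a : c + p ≡ a
  c+p≡a = m∸n+n≡m (≤-trans p≤N (m≤n*m (suc b) 4))
  S : List (Subset n × Subset n)
  S = distinctPairs E
  admissible : All (Admissible b p) S
  admissible = All.tabulate λ e,e′∈S →
    let e∈E , e′∈E , e≢e′ = ∈-distinctPairs⁻ E e,e′∈S in All.lookup small e∈E , far e∈E e′∈E e≢e′
  pairs*2≤2^H : length S * 2 ≤ 2 ^ H
  pairs*2≤2^H = begin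
    length S * 2                 ≤⟨ *-monoˡ-≤ 2 (length-distinctPairs E) ⟩
    length E * length E * 2      ≤⟨ *-monoˡ-≤ 2 (*-mono-≤ (n≤2^⌈log₂n⌉ (length E)) (n≤2^⌈log₂n⌉ (length E))) ⟩
    2 ^ L * 2 ^ L * 2            ≡⟨ cong (_* 2) (^-distribˡ-+-* 2 L L) ⟨
    2 ^ (L + L) * 2              ≡⟨ *-comm (2 ^ (L + L)) 2 ⟩
    2 ^ suc (L + L)              ≡⟨ cong (λ x → 2 ^ suc (L + x)) (+-identityʳ L) ⟨
    2 ^ H                        ∎
    where open ≤-Reasoning
  fewPairs : c ^ (k * H) * length S * 2 ≤ a ^ (k * H)
  fewPairs = begin
    c ^ (k * H) * length S * 2   ≡⟨ *-assoc (c ^ (k * H)) (length S) 2 ⟩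
    c ^ (k * H) * (length S * 2) ≤⟨ *-monoʳ-≤ (c ^ (k * H)) pairs*2≤2^H ⟩
    c ^ (k * H) * 2 ^ H          ≡⟨ cong (_* 2 ^ H) (^-*-assoc c k H) ⟨
    (c ^ k) ^ H * 2 ^ H          ≡⟨ *-^-distribʳ (c ^ k) 2 H ⟨
    (c ^ k * 2) ^ H              ≤⟨ ^-monoˡ-≤ H (bernoulli-halving a c p k c+p≡a a≤kp) ⟩
    (a ^ k) ^ H                  ≡⟨ ^-*-assoc a k H ⟩
    a ^ (k * H)                  ∎
    where open ≤-Reasoning
  separating : (chosen : Vec (Subset n) (k * H)) →
    a ^ (k * H) * length (uncoveredAfter separates chosen S) ≤ c ^ (k * H) * length S →
    Separating (lookup chosen) E
  separating chosen shrunk e∈E e′∈E e≢e′ =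
    let none = x*2≤y∧y*r≤x⇒r≡0 _ {{m^n≢0 a (k * H)}} fewPairs shrunk
        i , sep = allCovered separates chosen (∈-distinctPairs⁺ e∈E e′∈E e≢e′) none
    in i , separates⇒≢ (lookup chosen i) _ _ sep

m<[1+m/n]*n : ∀ m n .{{_ : NonZero n}} → m < suc (m / n) * n
m<[1+m/n]*n m n = begin-strict
  m                  ≡⟨ m≡m%n+[m/n]*n m n ⟩
  m % n + m / n * n  <⟨ +-monoˡ-< (m / n * n) (m%n<n m n) ⟩
  suc (m / n) * n    ∎
  where open ≤-Reasoning

[1+m/n]*n≤n+m : ∀ m n .{{_ : NonZero n}} → suc (m / n) * n ≤ n + m
[1+m/n]*n≤n+m m n = +-monoʳ-≤ n (m/n*n≤m m n)

poolCount*p≤27dL : ∀ d p L .{{_ : NonZero p}} → p ≤ d → 1 ≤ L →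
  suc (8 * d / p) * suc (2 * L) * p ≤ 27 * d * L
poolCount*p≤27dL d p L p≤d 1≤L = begin
    k * suc (2 * L) * p
  ≡⟨ solve 3 (λ k H p → k :* H :* p := H :* (k :* p)) refl k (suc (2 * L)) p ⟩
    suc (2 * L) * (k * p)
  ≤⟨ *-mono-≤ (+-monoˡ-≤ (2 * L) 1≤L) (≤-trans ([1+m/n]*n≤n+m (8 * d) p) (+-monoˡ-≤ (8 * d) p≤d)) ⟩
    (L + 2 * L) * (d + 8 * d)
  ≡⟨ solve 2 (λ L d → (L :+ con 2 :* L) :* (d :+ con 8 :* d) := con 27 :* d :* L) refl L d ⟩
    27 * d * L
  ∎
  where
  open ≤-Reasoning
  k : ℕ
  k = suc (8 * d / p)

fewTestsSuffice : ∀ d p .{{_ : NonZero p}} → p ≤ d → ∀ {n} (E : List (Subset n)) →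
  All (λ e → ∣ e ∣ ≤ d) E → (∀ {e e′} → e ∈ E → e′ ∈ E → e ≢ e′ → p ≤ ∣ e′ ─ e ∣) →
  ∃ λ (A : NonAdaptive n (suc (8 * d / p) * suc (2 * ⌈log₂ length E ⌉))) → Finds A E
fewTestsSuffice zero (suc _) ()
fewTestsSuffice d@(suc d′) p p≤d E small far =
  let chosen , separating = separatingPools b p k p≤1+b 4[1+b]≤kp E (All.map 2m≤1+b small) far
  in separating⇒finds (lookup chosen) E separating
  where
  b k : ℕ
  b = d′ + d
  k = suc (8 * d / p)
  2d≡1+b : 2 * d ≡ suc b
  2d≡1+b = cong (λ x → suc (d′ + x)) (+-identityʳ d)
  2m≤1+b : ∀ {m} → m ≤ d → 2 * m ≤ suc b
  2m≤1+b m≤d = ≤-trans (*-monoʳ-≤ 2 m≤d) (≤-reflexive 2d≡1+b)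
  p≤1+b : p ≤ suc b
  p≤1+b = ≤-trans (m≤n*m p 2) (2m≤1+b p≤d)
  4[1+b]≤kp : 4 * suc b ≤ k * p
  4[1+b]≤kp = subst (_≤ k * p) (trans (*-assoc 4 2 d) (cong (4 *_) 2d≡1+b)) (<⇒≤ (m<[1+m/n]*n (8 * d) p))

corollary1 : ∃ λ (C : ℕ) → ∀ (d n : ℕ) → 1 ≤ d → d ≤ n →
    (E : List (Subset n)) → Unique E → All (λ e → ∣ e ∣ ≤ d) E →
    (p : ℕ) → 1 ≤ p →
    (∀ e e′ → e ∈ E → e′ ∈ E → e ≢ e′ → p ≤ ∣ e′ ─ e ∣) →
    ∃ λ (t : ℕ) → (t * p ≤ C * d * ⌈log₂ length E ⌉) ×
    ∃ λ (A : NonAdaptive n t) → Finds A E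
corollary1 = 27 , λ where
  _ _ _ _ [] _ _ _ _ _ → 0 , z≤n , separating⇒finds (λ ()) [] (λ ())
  _ _ _ _ (e ∷ []) _ _ _ _ _ →
    0 , z≤n , separating⇒finds (λ ()) (e ∷ []) (λ { (here refl) (here refl) e≢e → contradiction refl e≢e })
  d _ _ _ E@(e₁ ∷ e₂ ∷ _) ((e₁≢e₂ All.∷ _) AllPairs.∷ _) small p@(suc _) _ far →
    let p≤d = ≤-trans (far e₁ e₂ (here refl) (there (here refl)) e₁≢e₂)
                (≤-trans (∣p─q∣≤∣p∣ e₂ e₁) (All.lookup small (there (here refl))))
    in _ , poolCount*p≤27dL d p _ p≤d (s≤s z≤n) , fewTestsSuffice d p p≤d E small (far _ _)
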